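{- There is exactly one positive integer $m$ such that $t(m)=t(4)$ and $t(m+1)=t(5)$ (namely $m=4$). Equivalently, the word $(t(4),t(5))=\big(((())),(())\big)$ occurs exactly once in the sequence $(t(n))_{n\ge 1}$.
   Context: For each positive integer $n$, define a finite ordered (planar) rooted tree $t(n)$ recursively: $t(1)$ is the tree consisting of a single root vertex; if $n>1$ has prime factorization $n=p_1^{n_1}\cdots p_k^{n_k}$ with primes $p_1<\dots<p_k$ and exponents $n_i\ge 1$, then $t(n)$ is the ordered rooted tree whose root has exactly $k$ children, ordered from left to right, where the subtree rooted at the $i$-th child is $t(n_i)$. Trees are compared as ordered rooted trees (up to isomorphism preserving root and the left-to-right order of children). In parenthesis notation, $t(1)=()$, $t(p)=(())$ for every prime $p$, and $t(4)=((()))$; thus $t(m)=t(4)$ iff $m=p^q$ with $p,q$ prime, and $t(m)=t(5)$ iff $m$ is prime. -}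

module Defs where

open import Data.Nat using (ℕ; zero; suc; _/_; _∸_)
open import Data.Nat.Divisibility using (_∣?_)
open import Data.Nat.Primality using (Prime; prime?)
open import Data.List using (List; []; _∷_; map; filter; upTo)
open import Relation.Nullary.Decidable using (_×-dec_; yes; no)

data Tree : Set where
  node : List Tree → Tree

primeDivisors : ℕ → List ℕ
primeDivisors n = filter (λ p → prime? p ×-dec (p ∣? n)) (upTo (suc n))

-- p-adic valuation of n (for p ≥ 2, n ≥ 1); fuel bounds the number of divisions.
valF : ℕ → ℕ → ℕ → ℕ
valF zero    p n = zero
valF (suc f) zero n = zero
valF (suc f) (suc zero) n = zero
valF (suc f) p@(suc (suc _)) zero = zero
valF (suc f) p@(suc (suc _)) n@(suc _) with p ∣? n
... | yes _ = suc (valF f p (n / p))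
... | no  _ = zero

val : ℕ → ℕ → ℕ
val p n = valF n p n

-- t with fuel: root has one child per prime p_i ∣ n (increasing order),
-- the i-th subtree being t(n_i) with n_i the exponent of p_i in n.
tF : ℕ → ℕ → Tree
tF zero    n = node []
tF (suc f) n = node (map (λ p → tF f (val p n)) (primeDivisors n))

-- t(n) for n ≥ 1 (fuel n suffices since every exponent of n is < n);
-- t(1) = node [] as there are no prime divisors.
t : ℕ → Tree
t n = tF n n

private
  open import Relation.Binary.PropositionalEquality using (_≡_; refl)
  test1 : t 4 ≡ node (node (node [] ∷ []) ∷ [])
  test1 = refl
  test2 : t 5 ≡ node (node [] ∷ [])
  test2 = refl
  test3 : t 9 ≡ t 4
  test3 = refl
  test4 : t 360 ≡ node (t 3 ∷ t 2 ∷ t 1 ∷ [])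
  test4 = refl
  test5 : t 1 ≡ node []
  test5 = refl

{-# OPTIONS --safe #-}
-- If t m = t 4 then m = p ^ q with p, q prime, and if t (m + 1) = t 5 then m + 1 is prime.
-- As m ≥ 4, the prime m + 1 is odd, so m is even and p = 2. If q were odd, then
-- 2 ^ q ≡ 2 (mod 3) and 3 would be a proper divisor of 2 ^ q + 1; hence q = 2 and m = 4.

module Submission where

open import Defs
open import Data.Nat using (ℕ; zero; suc; _≤_; _+_; _*_; _^_; z≤n; s≤s; _/_; nonTrivial⇒n>1)
open import Data.Nat.Properties
open import Data.Nat.Divisibility
  using (_∣_; divides; _∣?_; ∣⇒≤; ∣-trans; ∣-refl; m∣m*n; n∣m*n; ∣n⇒∣m*n; ∣m+n∣m⇒∣n; ∣1⇒≡1)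
open import Data.Nat.DivMod using (m*[n/m]≡n; m/n<m; m≥n⇒m/n>0)
open import Data.Nat.Primality using (Prime; prime?; prime[2]; prime⇒irreducible; prime⇒nonTrivial; euclidsLemma)
open import Data.Nat.Primality.Factorisation using (factorise)
open import Data.Nat.Tactic.RingSolver using (solve-∀)
open import Data.List using ([]; _∷_; upTo)
open import Data.Nat.ListAction using (product)
open import Data.List.Membership.Propositional using (_∈_)
open import Data.List.Membership.Propositional.Properties using (∈-filter⁺; ∈-filter⁻; ∈-upTo⁺)
open import Data.List.Relation.Unary.Any using (here)
open import Data.List.Relation.Unary.Any.Properties using (¬Any[])
open import Data.List.Relation.Unary.All using (_∷_)
open import Data.Product using (Σ; ∃₂; _×_; _,_; proj₁; proj₂)
open import Data.Sum using (_⊎_; inj₁; inj₂)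
open import Data.Empty using (⊥-elim)
open import Relation.Nullary using (¬_; yes; no)
open import Relation.Nullary.Decidable using (_×-dec_)
open import Relation.Binary.PropositionalEquality using (_≡_; refl; sym; trans; cong; subst; module ≡-Reasoning)

prime⇒2≤ : ∀ {p} → Prime p → 2 ≤ p
prime⇒2≤ {p} pp = nonTrivial⇒n>1 p {{prime⇒nonTrivial pp}}

2∣n⊎2∣1+n : ∀ n → 2 ∣ n ⊎ 2 ∣ suc n
2∣n⊎2∣1+n zero = inj₁ (divides 0 refl)
2∣n⊎2∣1+n (suc n) with 2∣n⊎2∣1+n n
... | inj₁ (divides q n≡q*2) = inj₂ (divides (suc q) (cong (λ x → suc (suc x)) n≡q*2))
... | inj₂ 2∣1+n = inj₁ 2∣1+n

prime∣m^n⇒∣m : ∀ {p} m n → Prime p → p ∣ m ^ n → p ∣ m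
prime∣m^n⇒∣m m zero pp p∣1 = ⊥-elim (<⇒≢ (prime⇒2≤ pp) (sym (∣1⇒≡1 p∣1)))
prime∣m^n⇒∣m m (suc n) pp p∣m*m^n with euclidsLemma m (m ^ n) pp p∣m*m^n
... | inj₁ p∣m   = p∣m
... | inj₂ p∣m^n = prime∣m^n⇒∣m m n pp p∣m^n

prime∧2∣⇒≡2 : ∀ {p} → Prime p → 2 ∣ p → p ≡ 2
prime∧2∣⇒≡2 pp 2∣p with prime⇒irreducible pp 2∣p
... | inj₁ ()
... | inj₂ 2≡p = sym 2≡p

prime⇒≡2⊎odd : ∀ {p} → Prime p → p ≡ 2 ⊎ Σ ℕ λ k → p ≡ suc (k * 2)
prime⇒≡2⊎odd {p} pp with 2∣n⊎2∣1+n p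
... | inj₁ 2∣p = inj₁ (prime∧2∣⇒≡2 pp 2∣p)
... | inj₂ (divides zero ())
... | inj₂ (divides (suc k) 1+p≡2+k*2) = inj₂ (k , suc-injective 1+p≡2+k*2)

prime[1+n]⇒2∣n : ∀ {n} → 2 ≤ n → Prime (suc n) → 2 ∣ n
prime[1+n]⇒2∣n {n} 2≤n p with 2∣n⊎2∣1+n n
... | inj₁ 2∣n = 2∣n
... | inj₂ 2∣1+n = ⊥-elim (<⇒≢ 2≤n (sym (suc-injective (prime∧2∣⇒≡2 p 2∣1+n))))

m≤m^n : ∀ m {n} → 1 ≤ n → m ≤ m ^ n
m≤m^n zero {suc n} _ = z≤n
m≤m^n m@(suc _) {n} 1≤n = subst (_≤ m ^ n) (*-identityʳ m) (^-monoʳ-≤ m 1≤n)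

-- 4 · (2^q + 1) = (2^(q+2) + 1) + 3
3∣1+2^odd : ∀ k → 3 ∣ suc (2 ^ suc (k * 2))
3∣1+2^odd zero = ∣-refl
3∣1+2^odd (suc k) = ∣m+n∣m⇒∣n (subst (3 ∣_) (shift (2 ^ suc (k * 2))) (∣n⇒∣m*n 4 (3∣1+2^odd k))) ∣-refl
  where
  shift : ∀ x → 4 * (1 + x) ≡ 3 + (1 + 2 * (2 * x))
  shift = solve-∀

∃-prime-divisor : ∀ {n} → 2 ≤ n → Σ ℕ λ p → Prime p × p ∣ n
∃-prime-divisor {n@(suc _)} 2≤n with factorise n
... | record { factors = [] ; isFactorisation = n≡1 } = ⊥-elim (<⇒≢ 2≤n (sym n≡1))
... | record { factors = p ∷ ps ; isFactorisation = n≡p*∏ps ; factorsPrime = pp ∷ _ } =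
  p , pp , subst (p ∣_) (sym n≡p*∏ps) (m∣m*n (product ps))

no-prime-divisor⇒≡1 : ∀ {n} → 1 ≤ n → (∀ {p} → Prime p → ¬ p ∣ n) → n ≡ 1
no-prime-divisor⇒≡1 {suc zero} _ _ = refl
no-prime-divisor⇒≡1 {suc (suc n)} _ no-p with ∃-prime-divisor (s≤s (s≤s (z≤n {n})))
... | p , pp , p∣n = ⊥-elim (no-p pp p∣n)

∈-primeDivisors⁻ : ∀ {n p} → p ∈ primeDivisors n → Prime p × p ∣ n
∈-primeDivisors⁻ {n} p∈ = ∈-filter⁻ (λ p → prime? p ×-dec (p ∣? n)) {xs = upTo (suc n)} p∈ .proj₂

∈-primeDivisors⁺ : ∀ {n p} → 1 ≤ n → Prime p → p ∣ n → p ∈ primeDivisors n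
∈-primeDivisors⁺ {suc n} _ pp p∣n =
  ∈-filter⁺ (λ p → prime? p ×-dec (p ∣? suc n)) (∈-upTo⁺ (s≤s (∣⇒≤ p∣n))) (pp , p∣n)

primeDivisors≡[]⇒≡1 : ∀ {n} → 1 ≤ n → primeDivisors n ≡ [] → n ≡ 1
primeDivisors≡[]⇒≡1 1≤n pd≡[] = no-prime-divisor⇒≡1 1≤n λ pp p∣n →
  ¬Any[] (subst (_ ∈_) pd≡[] (∈-primeDivisors⁺ 1≤n pp p∣n))

valF-decomposition : ∀ f r n → 2 ≤ r → 1 ≤ n → n ≤ f → Σ ℕ λ k → n ≡ r ^ valF f r n * k × ¬ r ∣ k
valF-decomposition (suc f) (suc zero) (suc _) (s≤s ()) _ _
valF-decomposition (suc f) r@(suc (suc _)) n@(suc _) 2≤r 1≤n (s≤s n≤f) with r ∣? n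
... | no r∤n = n , sym (+-identityʳ n) , r∤n
... | yes r∣n with valF-decomposition f r (n / r) 2≤r (m≥n⇒m/n>0 (∣⇒≤ r∣n)) n/r≤f
  where n/r≤f = ≤-trans (≤-pred (m/n<m n r 2≤r)) n≤f
...   | k , n/r≡r^v*k , r∤k = k , n≡r*r^v*k , r∤k
  where
  open ≡-Reasoning
  n≡r*r^v*k : n ≡ r * r ^ valF f r (n / r) * k
  n≡r*r^v*k = begin
    n                               ≡⟨ m*[n/m]≡n r∣n ⟨
    r * (n / r)                     ≡⟨ cong (r *_) n/r≡r^v*k ⟩
    r * (r ^ valF f r (n / r) * k)  ≡⟨ *-assoc r (r ^ valF f r (n / r)) k ⟨
    r * r ^ valF f r (n / r) * k    ∎

val-decomposition : ∀ r n → 2 ≤ r → 1 ≤ n → Σ ℕ λ k → n ≡ r ^ val r n * k × ¬ r ∣ k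
val-decomposition r n 2≤r 1≤n = valF-decomposition n r n 2≤r 1≤n ≤-refl

val-positive : ∀ {r n} → 2 ≤ r → 1 ≤ n → r ∣ n → 1 ≤ val r n
val-positive {r} {n} 2≤r 1≤n r∣n with val-decomposition r n 2≤r 1≤n
... | k , n≡r^v*k , r∤k = n≢0⇒n>0 λ v≡0 →
  r∤k (subst (r ∣_) (trans n≡r^v*k (trans (cong (λ v → r ^ v * k) v≡0) (*-identityˡ k))) r∣n)

primeDivisors≡[p]⇒prime∧∣ : ∀ {n p} → primeDivisors n ≡ p ∷ [] → Prime p × p ∣ n
primeDivisors≡[p]⇒prime∧∣ {n} {p} pd≡[p] = ∈-primeDivisors⁻ {n} (subst (p ∈_) (sym pd≡[p]) (here refl))

primeDivisors≡[p]⇒≡p^val : ∀ {n p} → 1 ≤ n → primeDivisors n ≡ p ∷ [] → n ≡ p ^ val p n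
primeDivisors≡[p]⇒≡p^val {n} {p} 1≤n pd≡[p] with val-decomposition p n (prime⇒2≤ pp) 1≤n
  where pp = primeDivisors≡[p]⇒prime∧∣ {n} pd≡[p] .proj₁
... | k , n≡p^v*k , p∤k = trans n≡p^v*k (trans (cong (p ^ val p n *_) k≡1) (*-identityʳ _))
  where
  1≤k : 1 ≤ k
  1≤k = n≢0⇒n>0 λ k≡0 →
    <⇒≢ 1≤n (sym (trans n≡p^v*k (trans (cong (p ^ val p n *_) k≡0) (*-zeroʳ (p ^ val p n)))))
  k≡1 : k ≡ 1
  k≡1 = no-prime-divisor⇒≡1 1≤k λ {q} pq q∣k →
    let q∣n = ∣-trans q∣k (subst (k ∣_) (sym n≡p^v*k) (n∣m*n (p ^ val p n)))
    in  p∤k (subst (_∣ k) (only-p (∈-primeDivisors⁺ {n} 1≤n pq q∣n)) q∣k)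
    where
    only-p : ∀ {q} → q ∈ primeDivisors n → q ≡ p
    only-p q∈ with subst (_ ∈_) pd≡[p] q∈
    ... | here q≡p = q≡p

-- Subtrees of t n are built with fuel n ∸ 1 rather than their own argument, hence fuel-generic lemmas.
tF-leaf⇒≡1 : ∀ f n → 1 ≤ n → tF (suc f) n ≡ node [] → n ≡ 1
tF-leaf⇒≡1 f n 1≤n eq with primeDivisors n in pd≡
tF-leaf⇒≡1 f n 1≤n refl | [] = primeDivisors≡[]⇒≡1 1≤n pd≡

tF-single-child : ∀ f n {x} → 1 ≤ n → tF (suc f) n ≡ node (x ∷ []) →
  Σ ℕ λ p → Prime p × n ≡ p ^ val p n × 1 ≤ val p n × tF f (val p n) ≡ x
tF-single-child f n 1≤n eq with primeDivisors n in pd≡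
tF-single-child f n 1≤n refl | p ∷ [] with primeDivisors≡[p]⇒prime∧∣ {n} pd≡
... | pp , p∣n =
  p , pp , primeDivisors≡[p]⇒≡p^val 1≤n pd≡ , val-positive (prime⇒2≤ pp) 1≤n p∣n , refl

tF≡t5⇒prime : ∀ f n → 1 ≤ n → tF (suc (suc f)) n ≡ t 5 → Prime n
tF≡t5⇒prime f n 1≤n eq with tF-single-child (suc f) n 1≤n eq
... | p , pp , n≡p^v , 1≤v , leaf = subst Prime (sym n≡p) pp
  where
  n≡p : n ≡ p
  n≡p = trans n≡p^v (trans (cong (p ^_) (tF-leaf⇒≡1 f (val p n) 1≤v leaf)) (*-identityʳ p))

t≡t5⇒prime : ∀ n → t n ≡ t 5 → Prime n
t≡t5⇒prime zero ()
t≡t5⇒prime (suc zero) ()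
t≡t5⇒prime (suc (suc f)) eq = tF≡t5⇒prime f (suc (suc f)) (s≤s z≤n) eq

t≡t4⇒prime^prime : ∀ n → t n ≡ t 4 → ∃₂ λ p q → Prime p × Prime q × n ≡ p ^ q
t≡t4⇒prime^prime zero ()
t≡t4⇒prime^prime (suc zero) ()
t≡t4⇒prime^prime (suc (suc zero)) ()
t≡t4⇒prime^prime n@(suc (suc (suc f))) eq with tF-single-child (suc (suc f)) n (s≤s z≤n) eq
... | p , pp , n≡p^v , 1≤v , v-tree = p , val p n , pp , tF≡t5⇒prime f (val p n) 1≤v v-tree , n≡p^v

1+p^q-prime⇒p^q≡4 : ∀ {p q} → Prime p → Prime q → Prime (suc (p ^ q)) → p ^ q ≡ 4
1+p^q-prime⇒p^q≡4 {p} {q} pp pq p1 with prime∧2∣⇒≡2 pp (prime∣m^n⇒∣m p q prime[2] p^q-even)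
  where
  p^q-even : 2 ∣ p ^ q
  p^q-even = prime[1+n]⇒2∣n (≤-trans (prime⇒2≤ pp) (m≤m^n p (≤-trans (s≤s z≤n) (prime⇒2≤ pq)))) p1
... | refl with prime⇒≡2⊎odd pq
...   | inj₁ refl = refl
...   | inj₂ (k , refl) with prime⇒irreducible p1 (3∣1+2^odd k)
...     | inj₁ ()
...     | inj₂ 3≡1+2^q = ⊥-elim (<⇒≢ (^-monoʳ-< 2 (s≤s (s≤s z≤n)) (prime⇒2≤ pq)) (suc-injective 3≡1+2^q))

mainTheorem1 : ∀ (m : ℕ) → 1 ≤ m →
    ((t m ≡ t 4 × t (suc m) ≡ t 5) → m ≡ 4) × ((m ≡ 4) → (t m ≡ t 4 × t (suc m) ≡ t 5))
mainTheorem1 m _ = forward , λ { refl → refl , refl }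
  where
  forward : t m ≡ t 4 × t (suc m) ≡ t 5 → m ≡ 4
  forward (tm≡t4 , t1+m≡t5) with t≡t4⇒prime^prime m tm≡t4
  ... | p , q , pp , pq , refl = 1+p^q-prime⇒p^q≡4 pp pq (t≡t5⇒prime (suc (p ^ q)) t1+m≡t5)
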